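{- Let $G$ be a graph with vertex set $V$, and let $W_1, W_2 \subseteq V$ be disjoint, with $W_1$ reducible in $G$ (so that $\Gamma_{W_1}(G)$ is defined). Then $W_2$ is reducible in $\Gamma_{W_1}(G)$ if and only if $W_1 \cup W_2$ is reducible in $G$. In this case, $\Gamma_{W_1 \cup W_2}(G) = \Gamma_{W_2}(\Gamma_{W_1}(G))$.
   Context: A graph is a finite graph with vertex set $V$ in which each pair of distinct vertices is either adjacent or not (no multiple edges), and each vertex may or may not carry a loop. Its adjacency matrix $A$ is the symmetric $V\times V$ matrix over $\mathbf{F}_2$ with $A_{vw}=1$ iff $v,w$ are adjacent ($v\neq w$) and $A_{vv}=1$ iff $v$ has a loop. Let $\mathcal{V}$ be the $\mathbf{F}_2$-vector space with basis $V$ and $\mathcal{E}$ the symmetric bilinear form $\mathcal{E}(x,y)=x^TAy$. For $W\subseteq V$, $\langle W\rangle$ is the span of $W$ and $\langle W\rangle^{\perp}=\{x\in\mathcal{V}:\mathcal{E}(x,w)=0\ \forall w\in\langle W\rangle\}$. A set $W\subseteq V$ is reducible in $G$ if $\langle W\rangle+\langle W\rangle^{\perp}=\mathcal{V}$. For reducible $W$, the graph reduction $\Gamma_W(G)$ is the graph on vertex set $V\setminus W$ in which, for $v,w\in V\setminus W$ (possibly $v=w$, which concerns a loop), $v$ and $w$ are adjacent iff $\mathcal{E}(v',w')=1$, where $v',w'\in\langle W\rangle^{\perp}$ are any vectors with $v-v'\in\langle W\rangle$ and $w-w'\in\langle W\rangle$ (such vectors exist and the value does not depend on the choice). -}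

module Defs where

open import Data.Nat using (ℕ; zero; suc)
open import Data.Bool using (Bool; true; false; _∧_; _xor_)
open import Data.Fin using (Fin; zero; suc; _≟_)
open import Data.Fin.Subset using (Subset; _∈_; _∉_; _⊆_; _─_)
open import Data.Fin.Subset.Properties using (_∈?_)
open import Data.Product using (Σ; _×_; _,_; proj₁; proj₂)
open import Relation.Nullary using (yes; no)
open import Relation.Nullary.Decidable using (⌊_⌋)
open import Relation.Binary.PropositionalEquality using (_≡_; subst)

-- Graphs are represented with their (finite) vertex set V given as a subset
-- of an ambient Fin n.  Only the entries of 'adj' between vertices of V matter.
record RawGraph (n : ℕ) : Set where
  constructor mkGraph
  field
    vertices : Subset n
    adj      : Fin n → Fin n → Bool   -- adjacency matrix over F₂ (loops on diagonal)
open RawGraph public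

IsGraph : ∀ {n} → RawGraph n → Set
IsGraph G = ∀ u v → u ∈ vertices G → v ∈ vertices G → adj G u v ≡ adj G v u

Vect : ℕ → Set
Vect n = Fin n → Bool

⊕ : ∀ {n} → (Fin n → Bool) → Bool
⊕ {zero}  f = false
⊕ {suc n} f = f zero xor ⊕ (λ i → f (suc i))

_+ᵥ_ : ∀ {n} → Vect n → Vect n → Vect n
(x +ᵥ y) u = x u xor y u

𝟘 : ∀ {n} → Vect n
𝟘 _ = false

e : ∀ {n} → Fin n → Vect n
e v u = ⌊ v ≟ u ⌋

In𝒱 : ∀ {n} → RawGraph n → Vect n → Set
In𝒱 G x = ∀ u → x u ≡ true → u ∈ vertices G

ℰ : ∀ {n} → RawGraph n → Vect n → Vect n → Bool
ℰ G x y = ⊕ (λ u → ⊕ (λ w → x u ∧ (adj G u w ∧ y w)))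

InSpan : ∀ {n} → Subset n → Vect n → Set
InSpan {n} W x = Σ (Fin n → Bool) λ c →
  (∀ v → c v ≡ true → v ∈ W) × (∀ u → x u ≡ ⊕ (λ v → c v ∧ e v u))

InPerp : ∀ {n} → RawGraph n → Subset n → Vect n → Set
InPerp G W x = In𝒱 G x × (∀ w → InSpan W w → ℰ G x w ≡ false)

-- W reducible: ⟨W⟩ + ⟨W⟩^⊥ = 𝒱, i.e. every x ∈ 𝒱 is a + b with a ∈ ⟨W⟩, b ∈ ⟨W⟩^⊥
-- (the inclusion ⟨W⟩ + ⟨W⟩^⊥ ⊆ 𝒱 is automatic for W ⊆ V).
Reducible : ∀ {n} → RawGraph n → Subset n → Set
Reducible {n} G W = ∀ x → In𝒱 G x →
  Σ (Vect n) λ a → Σ (Vect n) λ b → InSpan W a × InPerp G W b × (∀ u → x u ≡ (a +ᵥ b) u)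

e∈𝒱 : ∀ {n} (G : RawGraph n) v → v ∈ vertices G → In𝒱 G (e v)
e∈𝒱 G v v∈ u eq with v ≟ u
... | yes v≡u = subst (λ z → z ∈ vertices G) v≡u v∈
e∈𝒱 G v v∈ u () | no _

-- v' : the ⟨W⟩^⊥-component of v given by the reducibility witness
-- (v - v' ∈ ⟨W⟩, v' ∈ ⟨W⟩^⊥); irrelevant (zero) for v ∉ V.
perpPart : ∀ {n} (G : RawGraph n) (W : Subset n) → Reducible G W → Fin n → Vect n
perpPart G W r v with v ∈? vertices G
... | yes v∈ = proj₁ (proj₂ (r (e v) (e∈𝒱 G v v∈)))
... | no  _  = 𝟘

Γ : ∀ {n} (G : RawGraph n) (W : Subset n) → Reducible G W → RawGraph n
Γ G W r = mkGraph (vertices G ─ W) (λ v w → ℰ G (perpPart G W r v) (perpPart G W r w))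

_≅_ : ∀ {n} → RawGraph n → RawGraph n → Set
G ≅ H = (vertices G ≡ vertices H) ×
        (∀ u v → u ∈ vertices G → v ∈ vertices G → adj G u v ≡ adj H u v)

-- Idea.  Write x ∼[ W ] y for x + y ∈ ⟨W⟩.  W is reducible iff every x ∈ 𝒱 is
-- congruent modulo ⟨W⟩ to some b ∈ ⟨W⟩^⊥, and for b ⊥ ⟨W⟩ the value ℰ(b, c)
-- only depends on the class of c.  Extending the chosen representatives
-- v ↦ v' of Γ_{W₁} linearly gives a map φ with φ(x) ∈ ⟨W₁⟩^⊥, x ∼[ W₁ ] φ(x)
-- on 𝒱, and ℰ_{Γ_{W₁}(G)}(x, y) = ℰ(φx, φy).  Hence φ carries ⟨W₂⟩^⊥ of
-- Γ_{W₁}(G) into ⟨W₁ ∪ W₂⟩^⊥ of G, and chaining congruences modulo ⟨W₁⟩ and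
-- ⟨W₂⟩ gives both directions of the equivalence and the equality of graphs.

module Submission where

open import Defs
open import Algebra.Bundles using (CommutativeRing; CommutativeMonoid)
import Algebra.Properties.CommutativeSemigroup as CommutativeSemigroupProperties
open import Data.Bool using (Bool; true; false; _∧_; _xor_)
open import Data.Bool.Properties
  using (xor-∧-commutativeRing; ∧-commutativeMonoid; xor-assoc; xor-comm; xor-same;
         xor-identityʳ; ∧-distribˡ-xor; ∧-assoc; ∧-comm; ∧-zeroʳ; ∧-identityʳ;
         ∧-conicalˡ; ∧-conicalʳ)
open import Data.Empty using (⊥-elim)
open import Data.Fin using (Fin; zero; suc; _≟_; punchIn)
open import Data.Fin.Properties using (punchInᵢ≢i)
open import Data.Fin.Subset using (Subset; _∈_; _∉_; _⊆_; _∪_; _─_; inside; outside)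
open import Data.Fin.Subset.Properties
  using (_∈?_; x∈p∪q⁻; p⊆p∪q; q⊆p∪q; p─q─r≡p─q∪r; x∈p∧x∉q⇒x∈p─q)
open import Data.Nat using (ℕ)
open import Data.Product using (Σ; _×_; _,_; proj₁; proj₂)
open import Data.Sum using (inj₁; inj₂)
open import Data.Vec.Base using (_∷_; here; there)
open import Function using (_∘_)
open import Function.Bundles using (_⇔_; mk⇔)
open import Relation.Nullary using (yes; no)
open import Relation.Nullary.Decidable using (⌊_⌋)
open import Relation.Binary.PropositionalEquality
  using (_≡_; _≢_; _≗_; refl; sym; trans; cong; cong₂; subst; module ≡-Reasoning)

open import Algebra.Properties.Semiring.Sum (CommutativeRing.semiring xor-∧-commutativeRing)
  using (sum; sum-cong-≗; sum-replicate-zero; sum-remove; ∑-distrib-+; ∑-comm;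
         *-distribˡ-sum; *-distribʳ-sum)
open CommutativeSemigroupProperties
  (CommutativeMonoid.commutativeSemigroup (CommutativeRing.+-commutativeMonoid xor-∧-commutativeRing))
  using () renaming (xy∙z≈xz∙y to xor-rearrange)
open CommutativeSemigroupProperties (CommutativeMonoid.commutativeSemigroup ∧-commutativeMonoid)
  using () renaming (x∙yz≈y∙xz to ∧-left-comm)

open ≡-Reasoning

private
  variable
    n : ℕ
    W W' S T p q : Subset n
    u : Fin n
    x y z : Vect n

-- The F₂-sum ⊕ of the statement is the library's monoid sum for the
-- Boolean ring (F₂, xor, ∧); this lets us reuse the library's summation laws.
⊕≡sum : (f : Fin n → Bool) → ⊕ f ≡ sum f
⊕≡sum {ℕ.zero}  f = refl
⊕≡sum {ℕ.suc n} f = cong (f zero xor_) (⊕≡sum (f ∘ suc))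

⊕-cong : {f g : Fin n → Bool} → f ≗ g → ⊕ f ≡ ⊕ g
⊕-cong {f = f} {g} f≗g = begin
  ⊕ f    ≡⟨ ⊕≡sum f ⟩
  sum f  ≡⟨ sum-cong-≗ f≗g ⟩
  sum g  ≡⟨ ⊕≡sum g ⟨
  ⊕ g    ∎

⊕-zero : {f : Fin n → Bool} → (∀ i → f i ≡ false) → ⊕ f ≡ false
⊕-zero {n} h = trans (⊕-cong h) (trans (⊕≡sum {n} (λ _ → false)) (sum-replicate-zero n))

⊕-xor : (f g : Fin n → Bool) → ⊕ (λ i → f i xor g i) ≡ ⊕ f xor ⊕ g
⊕-xor f g = begin
  ⊕ (λ i → f i xor g i)  ≡⟨ ⊕≡sum (λ i → f i xor g i) ⟩
  sum (λ i → f i xor g i) ≡⟨ ∑-distrib-+ f g ⟩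
  sum f xor sum g         ≡⟨ cong₂ _xor_ (⊕≡sum f) (⊕≡sum g) ⟨
  ⊕ f xor ⊕ g             ∎

⊕-comm : ∀ {m} (f : Fin n → Fin m → Bool) →
  ⊕ (λ i → ⊕ (λ j → f i j)) ≡ ⊕ (λ j → ⊕ (λ i → f i j))
⊕-comm f = begin
  ⊕ (λ i → ⊕ (f i))                   ≡⟨ ⊕-cong (λ i → ⊕≡sum (f i)) ⟩
  ⊕ (λ i → sum (f i))                 ≡⟨ ⊕≡sum (λ i → sum (f i)) ⟩
  sum (λ i → sum (f i))               ≡⟨ ∑-comm f ⟩
  sum (λ j → sum (λ i → f i j))       ≡⟨ ⊕≡sum (λ j → sum (λ i → f i j)) ⟨
  ⊕ (λ j → sum (λ i → f i j))         ≡⟨ ⊕-cong (λ j → ⊕≡sum (λ i → f i j)) ⟨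
  ⊕ (λ j → ⊕ (λ i → f i j))           ∎

∧-distribˡ-⊕ : ∀ b (f : Fin n → Bool) → b ∧ ⊕ f ≡ ⊕ (λ i → b ∧ f i)
∧-distribˡ-⊕ b f = trans (cong (b ∧_) (⊕≡sum f))
                         (trans (*-distribˡ-sum b f) (sym (⊕≡sum (λ i → b ∧ f i))))

∧-distribʳ-⊕ : ∀ b (f : Fin n → Bool) → ⊕ f ∧ b ≡ ⊕ (λ i → f i ∧ b)
∧-distribʳ-⊕ b f = trans (cong (_∧ b) (⊕≡sum f))
                         (trans (*-distribʳ-sum b f) (sym (⊕≡sum (λ i → f i ∧ b))))

⊕-pull : ∀ {m} (c : Fin m → Bool) (g : Fin m → Fin n → Bool) →
  ⊕ (λ i → ⊕ (λ j → c j ∧ g j i)) ≡ ⊕ (λ j → c j ∧ ⊕ (λ i → g j i))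
⊕-pull c g = trans (⊕-comm (λ i j → c j ∧ g j i))
                   (⊕-cong (λ j → sym (∧-distribˡ-⊕ (c j) (g j))))

⊕-true : (f : Fin n → Bool) → ⊕ f ≡ true → Σ (Fin n) λ i → f i ≡ true
⊕-true {ℕ.suc n} f h with f zero in eq
... | true  = zero , eq
... | false with ⊕-true (f ∘ suc) h
...   | i , fi = suc i , fi

xor-cancelˡ : ∀ a b → a xor (a xor b) ≡ b
xor-cancelˡ a b = trans (sym (xor-assoc a a b)) (cong (_xor b) (xor-same a))

xor-cancelʳ : ∀ a b → (a xor b) xor b ≡ a
xor-cancelʳ a b = trans (xor-assoc a b b) (trans (cong (a xor_) (xor-same b)) (xor-identityʳ a))

e-diag : (u : Fin n) → e u u ≡ true
e-diag u with u ≟ u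
... | yes _   = refl
... | no u≢u = ⊥-elim (u≢u refl)

e-off : {v u : Fin n} → v ≢ u → e v u ≡ false
e-off {v = v} {u} v≢u with v ≟ u
... | yes v≡u = ⊥-elim (v≢u v≡u)
... | no _    = refl

lincomb : (Fin n → Bool) → (Fin n → Vect n) → Vect n
lincomb c f t = ⊕ (λ v → c v ∧ f v t)

lincomb-e : (c : Fin n → Bool) → lincomb c e ≗ c
lincomb-e {ℕ.suc n} c u = begin
  ⊕ t                         ≡⟨ ⊕≡sum t ⟩
  sum t                       ≡⟨ sum-remove {i = u} t ⟩
  t u xor sum (t ∘ punchIn u) ≡⟨ cong₂ _xor_ diagonal off-diagonal ⟩
  c u xor false               ≡⟨ xor-identityʳ (c u) ⟩
  c u                         ∎
  where
  t : Fin (ℕ.suc n) → Bool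
  t v = c v ∧ e v u
  diagonal : t u ≡ c u
  diagonal = trans (cong (c u ∧_) (e-diag u)) (∧-identityʳ (c u))
  off-diagonal : sum (t ∘ punchIn u) ≡ false
  off-diagonal = trans (sym (⊕≡sum (t ∘ punchIn u)))
    (⊕-zero (λ j → trans (cong (c (punchIn u j) ∧_) (e-off (punchInᵢ≢i u j)))
                         (∧-zeroʳ (c (punchIn u j)))))

lincomb-+ : (c : Fin n → Bool) (f g : Fin n → Vect n) →
  lincomb c f +ᵥ lincomb c g ≗ lincomb c (λ v → f v +ᵥ g v)
lincomb-+ c f g t = sym (trans (⊕-cong (λ v → ∧-distribˡ-xor (c v) (f v t) (g v t)))
                               (⊕-xor (λ v → c v ∧ f v t) (λ v → c v ∧ g v t)))

module _ {n : ℕ} (G : RawGraph n) where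

  ℰ-cong : {x x' y y' : Vect n} → x ≗ x' → y ≗ y' → ℰ G x y ≡ ℰ G x' y'
  ℰ-cong x≗x' y≗y' = ⊕-cong λ u → ⊕-cong λ w →
    cong₂ (λ a b → a ∧ (adj G u w ∧ b)) (x≗x' u) (y≗y' w)

  ℰ-+ʳ : (x y z : Vect n) → ℰ G x (y +ᵥ z) ≡ ℰ G x y xor ℰ G x z
  ℰ-+ʳ x y z = begin
    ⊕ (λ u → ⊕ (λ w → x u ∧ (adj G u w ∧ (y w xor z w))))
      ≡⟨ ⊕-cong (λ u → ⊕-cong (λ w → distrib u w)) ⟩
    ⊕ (λ u → ⊕ (λ w → term y u w xor term z u w))
      ≡⟨ ⊕-cong (λ u → ⊕-xor (term y u) (term z u)) ⟩
    ⊕ (λ u → ⊕ (term y u) xor ⊕ (term z u))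
      ≡⟨ ⊕-xor (λ u → ⊕ (term y u)) (λ u → ⊕ (term z u)) ⟩
    ℰ G x y xor ℰ G x z
      ∎
    where
    term : Vect n → Fin n → Fin n → Bool
    term y u w = x u ∧ (adj G u w ∧ y w)
    distrib : ∀ u w → x u ∧ (adj G u w ∧ (y w xor z w)) ≡ term y u w xor term z u w
    distrib u w = trans (cong (x u ∧_) (∧-distribˡ-xor (adj G u w) (y w) (z w)))
                        (∧-distribˡ-xor (x u) (adj G u w ∧ y w) (adj G u w ∧ z w))

  ℰ-𝟘ˡ : (y : Vect n) → ℰ G 𝟘 y ≡ false
  ℰ-𝟘ˡ y = ⊕-zero {n} (λ u → ⊕-zero {n} (λ w → refl))

  ℰ-linˡ : (c : Fin n → Bool) (f : Fin n → Vect n) (y : Vect n) →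
    ℰ G (lincomb c f) y ≡ ⊕ (λ v → c v ∧ ℰ G (f v) y)
  ℰ-linˡ c f y = begin
    ⊕ (λ u → ⊕ (λ w → lincomb c f u ∧ (adj G u w ∧ y w)))
      ≡⟨ ⊕-cong (λ u → ⊕-cong (λ w → expand u w)) ⟩
    ⊕ (λ u → ⊕ (λ w → ⊕ (λ v → c v ∧ (f v u ∧ (adj G u w ∧ y w)))))
      ≡⟨ ⊕-cong (λ u → ⊕-pull c (λ v w → f v u ∧ (adj G u w ∧ y w))) ⟩
    ⊕ (λ u → ⊕ (λ v → c v ∧ ⊕ (λ w → f v u ∧ (adj G u w ∧ y w))))
      ≡⟨ ⊕-pull c (λ v u → ⊕ (λ w → f v u ∧ (adj G u w ∧ y w))) ⟩
    ⊕ (λ v → c v ∧ ℰ G (f v) y)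
      ∎
    where
    expand : ∀ u w → lincomb c f u ∧ (adj G u w ∧ y w)
                   ≡ ⊕ (λ v → c v ∧ (f v u ∧ (adj G u w ∧ y w)))
    expand u w = trans (∧-distribʳ-⊕ (adj G u w ∧ y w) (λ v → c v ∧ f v u))
                       (⊕-cong (λ v → ∧-assoc (c v) (f v u) (adj G u w ∧ y w)))

  ℰ-linʳ : (x : Vect n) (c : Fin n → Bool) (f : Fin n → Vect n) →
    ℰ G x (lincomb c f) ≡ ⊕ (λ v → c v ∧ ℰ G x (f v))
  ℰ-linʳ x c f = begin
    ⊕ (λ u → ⊕ (λ w → x u ∧ (adj G u w ∧ lincomb c f w)))
      ≡⟨ ⊕-cong (λ u → ⊕-cong (λ w → expand u w)) ⟩
    ⊕ (λ u → ⊕ (λ w → ⊕ (λ v → c v ∧ (x u ∧ (adj G u w ∧ f v w)))))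
      ≡⟨ ⊕-cong (λ u → ⊕-pull c (λ v w → x u ∧ (adj G u w ∧ f v w))) ⟩
    ⊕ (λ u → ⊕ (λ v → c v ∧ ⊕ (λ w → x u ∧ (adj G u w ∧ f v w))))
      ≡⟨ ⊕-pull c (λ v u → ⊕ (λ w → x u ∧ (adj G u w ∧ f v w))) ⟩
    ⊕ (λ v → c v ∧ ℰ G x (f v))
      ∎
    where
    expand : ∀ u w → x u ∧ (adj G u w ∧ lincomb c f w)
                   ≡ ⊕ (λ v → c v ∧ (x u ∧ (adj G u w ∧ f v w)))
    expand u w = begin
      x u ∧ (adj G u w ∧ lincomb c f w)
        ≡⟨ cong (x u ∧_) (∧-distribˡ-⊕ (adj G u w) (λ v → c v ∧ f v w)) ⟩
      x u ∧ ⊕ (λ v → adj G u w ∧ (c v ∧ f v w))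
        ≡⟨ ∧-distribˡ-⊕ (x u) (λ v → adj G u w ∧ (c v ∧ f v w)) ⟩
      ⊕ (λ v → x u ∧ (adj G u w ∧ (c v ∧ f v w)))
        ≡⟨ ⊕-cong (λ v → trans (cong (x u ∧_) (∧-left-comm (adj G u w) (c v) (f v w)))
                               (∧-left-comm (x u) (c v) (adj G u w ∧ f v w))) ⟩
      ⊕ (λ v → c v ∧ (x u ∧ (adj G u w ∧ f v w)))
        ∎

  ℰ-sym : IsGraph G → {x y : Vect n} → In𝒱 G x → In𝒱 G y → ℰ G x y ≡ ℰ G y x
  ℰ-sym isGraph {x} {y} x∈𝒱 y∈𝒱 =
    trans (⊕-cong (λ u → ⊕-cong (λ w → transpose u w)))
          (⊕-comm (λ u w → y w ∧ (adj G w u ∧ x u)))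
    where
    transpose : ∀ u w → x u ∧ (adj G u w ∧ y w) ≡ y w ∧ (adj G w u ∧ x u)
    transpose u w with x u in xu | y w in yw
    ... | true  | true  = cong (_∧ true) (isGraph u w (x∈𝒱 u xu) (y∈𝒱 w yw))
    ... | true  | false = ∧-zeroʳ (adj G u w)
    ... | false | true  = sym (∧-zeroʳ (adj G w u))
    ... | false | false = refl

x∈p─q⁻ : (p q : Subset n) → u ∈ p ─ q → u ∈ p × u ∉ q
x∈p─q⁻ (inside ∷ p)  (outside ∷ q) here = here , λ ()
x∈p─q⁻ {u = zero} (outside ∷ p) (outside ∷ q) ()
x∈p─q⁻ {u = zero} (outside ∷ p) (inside ∷ q) ()
x∈p─q⁻ {u = zero} (inside ∷ p) (inside ∷ q) ()
x∈p─q⁻ (_ ∷ p)       (_ ∷ q)       (there u∈p─q) with x∈p─q⁻ p q u∈p─q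
... | u∈p , u∉q = there u∈p , λ { (there u∈q) → u∉q u∈q }

∪-resolve : u ∈ S ∪ T → u ∉ T → u ∈ S
∪-resolve {S = S} {T} u∈S∪T u∉T with x∈p∪q⁻ S T u∈S∪T
... | inj₁ u∈S = u∈S
... | inj₂ u∈T = ⊥-elim (u∉T u∈T)

∈-∪-─ : u ∈ p → u ∈ q ∪ (p ─ q)
∈-∪-─ {u = u} {p} {q} u∈p with u ∈? q
... | yes u∈q = p⊆p∪q (p ─ q) u∈q
... | no u∉q  = q⊆p∪q q (p ─ q) (x∈p∧x∉q⇒x∈p─q u∈p u∉q)

-- Supp W x : x is supported in W; this is membership in ⟨W⟩ (supp⇒span,
-- span⇒supp), and In𝒱 G is Supp (vertices G).
Supp : Subset n → Vect n → Set
Supp W x = ∀ u → x u ≡ true → u ∈ W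

supp-≗ : x ≗ y → Supp W x → Supp W y
supp-≗ x≗y x⊆W u yu = x⊆W u (trans (x≗y u) yu)

supp-mono : W ⊆ W' → Supp W x → Supp W' x
supp-mono W⊆W' x⊆W u xu = W⊆W' (x⊆W u xu)

supp-+ : Supp W x → Supp W y → Supp W (x +ᵥ y)
supp-+ {x = x} {y = y} x⊆W y⊆W u h with x u in xu | y u in yu
... | true  | _    = x⊆W u xu
... | false | true = y⊆W u yu

supp⇒span : Supp W x → InSpan W x
supp⇒span {x = x} x⊆W = x , x⊆W , λ u → sym (lincomb-e x u)

span⇒supp : InSpan W x → Supp W x
span⇒supp (c , c⊆W , x≗) u xu = c⊆W u (trans (sym (lincomb-e c u)) (trans (sym (x≗ u)) xu))

lincomb-supp : {c : Fin n → Bool} {f : Fin n → Vect n} →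
  (∀ v → c v ≡ true → Supp W (f v)) → Supp W (lincomb c f)
lincomb-supp {c = c} {f} f⊆W u h with ⊕-true (λ v → c v ∧ f v u) h
... | v , cv∧fvu = f⊆W v (∧-conicalˡ (c v) (f v u) cv∧fvu) u (∧-conicalʳ (c v) (f v u) cv∧fvu)

-- x ∼[ W ] y : x and y are congruent modulo ⟨W⟩.  (A record rather than a
-- synonym for Supp W (x +ᵥ y), so that x and y can be inferred from it.)
infix 4 _∼[_]_
record _∼[_]_ (x : Vect n) (W : Subset n) (y : Vect n) : Set where
  constructor congruent
  field difference : Supp W (x +ᵥ y)
open _∼[_]_

∼-sym : x ∼[ W ] y → y ∼[ W ] x
∼-sym {x = x} {y = y} (congruent x+y⊆W) =
  congruent (supp-≗ (λ u → xor-comm (x u) (y u)) x+y⊆W)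

∼-trans : x ∼[ W ] y → y ∼[ W ] z → x ∼[ W ] z
∼-trans {x = x} {y = y} {z = z} (congruent x+y⊆W) (congruent y+z⊆W) =
  congruent (supp-≗ telescope (supp-+ x+y⊆W y+z⊆W))
  where
  telescope : (x +ᵥ y) +ᵥ (y +ᵥ z) ≗ x +ᵥ z
  telescope u = trans (xor-assoc (x u) (y u) (y u xor z u)) (cong (x u xor_) (xor-cancelˡ (y u) (z u)))

∼-mono : W ⊆ W' → x ∼[ W ] y → x ∼[ W' ] y
∼-mono W⊆W' (congruent x+y⊆W) = congruent (supp-mono W⊆W' x+y⊆W)

∼-shift : Supp W z → x ∼[ W ] x +ᵥ z
∼-shift {z = z} {x = x} z⊆W = congruent (supp-≗ (λ u → sym (xor-cancelˡ (x u) (z u))) z⊆W)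

keep : Subset n → Vect n → Vect n
keep T x u = x u ∧ ⌊ u ∈? T ⌋

keep-supp : (x : Vect n) → Supp T (keep T x)
keep-supp {T = T} x u h with x u | u ∈? T
... | true | yes u∈T = u∈T

keep-∼ : Supp (S ∪ T) x → x ∼[ S ] keep T x
keep-∼ {S = S} {T = T} {x = x} x⊆S∪T = congruent difference-in-S
  where
  difference-in-S : Supp S (x +ᵥ keep T x)
  difference-in-S u h with x u in xu | u ∈? T
  ... | true | no u∉T = ∪-resolve (x⊆S∪T u xu) u∉T

module _ {n : ℕ} (G : RawGraph n) where

  PerpRepresentative : Subset n → Vect n → Set
  PerpRepresentative W x = Σ (Vect n) λ b → InPerp G W b × x ∼[ W ] b

  decomposition⇒∼ : {W : Subset n} {a b x : Vect n} →
    InSpan W a → (∀ u → x u ≡ (a +ᵥ b) u) → x ∼[ W ] b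
  decomposition⇒∼ {a = a} {b} a∈⟨W⟩ x≗a+b = congruent (supp-≗
    (λ u → trans (sym (xor-cancelʳ (a u) (b u))) (cong (_xor b u) (sym (x≗a+b u))))
    (span⇒supp a∈⟨W⟩))

  reducible⇒representative : {W : Subset n} → Reducible G W →
    {x : Vect n} → In𝒱 G x → PerpRepresentative W x
  reducible⇒representative r {x} x∈𝒱 with r x x∈𝒱
  ... | a , b , a∈⟨W⟩ , b⊥W , x≗a+b = b , b⊥W , decomposition⇒∼ a∈⟨W⟩ x≗a+b

  representative⇒reducible : {W : Subset n} →
    (∀ {x} → In𝒱 G x → PerpRepresentative W x) → Reducible G W
  representative⇒reducible rep x x∈𝒱 with rep x∈𝒱
  ... | b , b⊥W , x∼b =
    x +ᵥ b , b , supp⇒span (difference x∼b) , b⊥W , λ u → sym (xor-cancelʳ (x u) (b u))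

  perp-orth : {W : Subset n} {b w : Vect n} → InPerp G W b → Supp W w → ℰ G b w ≡ false
  perp-orth b⊥W w⊆W = proj₂ b⊥W _ (supp⇒span w⊆W)

  perp-resp : {W : Subset n} {b c c' : Vect n} →
    InPerp G W b → c ∼[ W ] c' → ℰ G b c ≡ ℰ G b c'
  perp-resp {b = b} {c} {c'} b⊥W c∼c' = sym (begin
    ℰ G b c'                     ≡⟨ ℰ-cong G {b} {b} (λ _ → refl) (λ u → sym (xor-cancelˡ (c u) (c' u))) ⟩
    ℰ G b (c +ᵥ (c +ᵥ c'))       ≡⟨ ℰ-+ʳ G b c (c +ᵥ c') ⟩
    ℰ G b c xor ℰ G b (c +ᵥ c')  ≡⟨ cong (ℰ G b c xor_) (perp-orth b⊥W (difference c∼c')) ⟩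
    ℰ G b c xor false            ≡⟨ xor-identityʳ (ℰ G b c) ⟩
    ℰ G b c                      ∎)

  perp-respˡ : IsGraph G → {W : Subset n} {b b' c : Vect n} → InPerp G W c →
    In𝒱 G b → In𝒱 G b' → b ∼[ W ] b' → ℰ G b c ≡ ℰ G b' c
  perp-respˡ isGraph c⊥W b∈𝒱 b'∈𝒱 b∼b' =
    trans (ℰ-sym G isGraph b∈𝒱 (proj₁ c⊥W))
          (trans (perp-resp c⊥W b∼b') (ℰ-sym G isGraph (proj₁ c⊥W) b'∈𝒱))

  -- The value ℰ(b, c) on ⟨W⟩^⊥ depends only on the classes of b and c modulo ⟨W⟩:
  -- this is why the adjacency of a reduced graph is well defined.
  ℰ-perp-invariant : IsGraph G → {W : Subset n} {b b' c c' : Vect n} →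
    InPerp G W b → InPerp G W b' → InPerp G W c' →
    b ∼[ W ] b' → c ∼[ W ] c' → ℰ G b c ≡ ℰ G b' c'
  ℰ-perp-invariant isGraph b⊥W b'⊥W c'⊥W b∼b' c∼c' =
    trans (perp-resp b⊥W c∼c') (perp-respˡ isGraph c'⊥W (proj₁ b⊥W) (proj₁ b'⊥W) b∼b')

  perpPart-perp : {W : Subset n} (r : Reducible G W) (v : Fin n) → InPerp G W (perpPart G W r v)
  perpPart-perp r v with v ∈? vertices G
  ... | yes v∈V = proj₁ (proj₂ (proj₂ (proj₂ (r (e v) (e∈𝒱 G v v∈V)))))
  ... | no _    = (λ u ()) , (λ w _ → ℰ-𝟘ˡ G w)

  perpPart-∼ : {W : Subset n} (r : Reducible G W) {v : Fin n} →
    v ∈ vertices G → e v ∼[ W ] perpPart G W r v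
  perpPart-∼ r {v} v∈V with v ∈? vertices G
  ... | no v∉V = ⊥-elim (v∉V v∈V)
  ... | yes v∈V' with r (e v) (e∈𝒱 G v v∈V')
  ...   | a , b , a∈⟨W⟩ , b⊥W , ev≗a+b = decomposition⇒∼ a∈⟨W⟩ ev≗a+b

module ReductionMap {n : ℕ} (G : RawGraph n) (W : Subset n) (r : Reducible G W) where

  φ : Vect n → Vect n
  φ x = lincomb x (perpPart G W r)

  φ-perp : (x : Vect n) → InPerp G W (φ x)
  φ-perp x = lincomb-supp (λ v _ → proj₁ (perpPart-perp G r v)) , orth
    where
    orth : ∀ w → InSpan W w → ℰ G (φ x) w ≡ false
    orth w w∈⟨W⟩ = trans (ℰ-linˡ G x (perpPart G W r) w)
      (⊕-zero (λ v → trans (cong (x v ∧_) (proj₂ (perpPart-perp G r v) w w∈⟨W⟩))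
                           (∧-zeroʳ (x v))))

  φ-∼ : {x : Vect n} → In𝒱 G x → x ∼[ W ] φ x
  φ-∼ {x} x∈𝒱 =
    congruent (supp-≗ regroup (lincomb-supp (λ v xv → difference (perpPart-∼ G r (x∈𝒱 v xv)))))
    where
    regroup : lincomb x (λ v → e v +ᵥ perpPart G W r v) ≗ x +ᵥ φ x
    regroup t = trans (sym (lincomb-+ x e (perpPart G W r) t))
                      (cong (_xor φ x t) (lincomb-e x t))

  ℰ-Γ : (x y : Vect n) → ℰ (Γ G W r) x y ≡ ℰ G (φ x) (φ y)
  ℰ-Γ x y = sym (begin
    ℰ G (φ x) (φ y)
      ≡⟨ ℰ-linˡ G x v' (φ y) ⟩
    ⊕ (λ u → x u ∧ ℰ G (v' u) (φ y))
      ≡⟨ ⊕-cong (λ u → cong (x u ∧_) (ℰ-linʳ G (v' u) y v')) ⟩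
    ⊕ (λ u → x u ∧ ⊕ (λ w → y w ∧ ℰ G (v' u) (v' w)))
      ≡⟨ ⊕-cong (λ u → ∧-distribˡ-⊕ (x u) (λ w → y w ∧ ℰ G (v' u) (v' w))) ⟩
    ⊕ (λ u → ⊕ (λ w → x u ∧ (y w ∧ ℰ G (v' u) (v' w))))
      ≡⟨ ⊕-cong (λ u → ⊕-cong (λ w → cong (x u ∧_) (∧-comm (y w) (ℰ G (v' u) (v' w))))) ⟩
    ℰ (Γ G W r) x y
      ∎)
    where
    v' : Fin n → Vect n
    v' = perpPart G W r

-- The setting of the theorem: W₂ ⊆ V disjoint from W₁, W₁ reducible in G,
-- and Γ₁ = Γ_{W₁}(G), whose vertex set is V ∖ W₁.
module TwoStepReduction {n : ℕ} (G : RawGraph n) (isGraph : IsGraph G)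
  (W₁ W₂ : Subset n) (W₂⊆V : W₂ ⊆ vertices G)
  (disjoint : ∀ v → v ∈ W₁ → v ∉ W₂) (r₁ : Reducible G W₁) where

  open ReductionMap G W₁ r₁

  V : Subset n
  V = vertices G

  Γ₁ : RawGraph n
  Γ₁ = Γ G W₁ r₁

  W₁⊆W₁∪W₂ : W₁ ⊆ W₁ ∪ W₂
  W₁⊆W₁∪W₂ = p⊆p∪q W₂

  W₂⊆W₁∪W₂ : W₂ ⊆ W₁ ∪ W₂
  W₂⊆W₁∪W₂ = q⊆p∪q W₁ W₂

  V∖W₁⊆V : V ─ W₁ ⊆ V
  V∖W₁⊆V u∈V∖W₁ = proj₁ (x∈p─q⁻ V W₁ u∈V∖W₁)

  W₂⊆V∖W₁ : W₂ ⊆ V ─ W₁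
  W₂⊆V∖W₁ {u} u∈W₂ = x∈p∧x∉q⇒x∈p─q (W₂⊆V u∈W₂) (λ u∈W₁ → disjoint u u∈W₁ u∈W₂)

  -- φ lifts ⟨W₂⟩^⊥ in Γ₁ into ⟨W₁ ∪ W₂⟩^⊥ in G: a vector w of ⟨W₁ ∪ W₂⟩ is
  -- congruent modulo ⟨W₁⟩ to its W₂-part w₂, and ℰ(φp, w₂) = ℰ(φp, φw₂) = ℰ_Γ₁(p, w₂).
  φ-perp-∪ : {p : Vect n} → InPerp Γ₁ W₂ p → InPerp G (W₁ ∪ W₂) (φ p)
  φ-perp-∪ {p} p⊥W₂ = proj₁ (φ-perp p) , λ w w∈⟨W₁∪W₂⟩ → orth (span⇒supp w∈⟨W₁∪W₂⟩)
    where
    orth : ∀ {w} → Supp (W₁ ∪ W₂) w → ℰ G (φ p) w ≡ false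
    orth {w} w⊆W₁∪W₂ = begin
      ℰ G (φ p) w         ≡⟨ perp-resp G (φ-perp p) (keep-∼ w⊆W₁∪W₂) ⟩
      ℰ G (φ p) w₂        ≡⟨ perp-resp G (φ-perp p) (φ-∼ (supp-mono W₂⊆V (keep-supp w))) ⟩
      ℰ G (φ p) (φ w₂)    ≡⟨ ℰ-Γ p w₂ ⟨
      ℰ Γ₁ p w₂           ≡⟨ perp-orth Γ₁ p⊥W₂ (keep-supp w) ⟩
      false               ∎
      where
      w₂ : Vect n
      w₂ = keep W₂ w

  -- (⇒) x ∼ x|_{V∖W₁} (mod ⟨W₁⟩) ∼ b (mod ⟨W₂⟩, b ⊥ W₂ in Γ₁) ∼ φb (mod ⟨W₁⟩).
  reducible-∪ : Reducible Γ₁ W₂ → Reducible G (W₁ ∪ W₂)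
  reducible-∪ r₂ = representative⇒reducible G representative
    where
    representative : ∀ {x} → In𝒱 G x → PerpRepresentative G (W₁ ∪ W₂) x
    representative {x} x∈𝒱 with reducible⇒representative Γ₁ r₂ (keep-supp {T = V ─ W₁} x)
    ... | b , b⊥W₂ , x|V∖W₁∼b = φ b , φ-perp-∪ b⊥W₂ ,
      ∼-trans (∼-mono W₁⊆W₁∪W₂ (keep-∼ {T = V ─ W₁} (λ u xu → ∈-∪-─ (x∈𝒱 u xu))))
     (∼-trans (∼-mono W₂⊆W₁∪W₂ x|V∖W₁∼b)
              (∼-mono W₁⊆W₁∪W₂ (φ-∼ (supp-mono V∖W₁⊆V (proj₁ b⊥W₂)))))

  -- (⇐) Given x ∈ 𝒱(Γ₁) and b ⊥ ⟨W₁ ∪ W₂⟩ with a = x + b ∈ ⟨W₁ ∪ W₂⟩, the vector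
  -- b₂ = x + a|_{W₂} lies in 𝒱(Γ₁), is congruent to x modulo ⟨W₂⟩, and to b
  -- modulo ⟨W₁⟩; the latter makes b₂ orthogonal to ⟨W₂⟩ in Γ₁.
  reducible-Γ : Reducible G (W₁ ∪ W₂) → Reducible Γ₁ W₂
  reducible-Γ r₁₂ = representative⇒reducible Γ₁ representative
    where
    representative : ∀ {x} → In𝒱 Γ₁ x → PerpRepresentative Γ₁ W₂ x
    representative {x} x∈𝒱₁ with reducible⇒representative G r₁₂ (supp-mono V∖W₁⊆V x∈𝒱₁)
    ... | b , b⊥W₁∪W₂ , x∼b = b₂ , (b₂∈𝒱₁ , orth) , ∼-shift (keep-supp a₁₂)
      where
      a₁₂ b₂ : Vect n
      a₁₂  = x +ᵥ b
      b₂ = x +ᵥ keep W₂ a₁₂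

      b₂∈𝒱₁ : In𝒱 Γ₁ b₂
      b₂∈𝒱₁ = supp-+ x∈𝒱₁ (supp-mono W₂⊆V∖W₁ (keep-supp a₁₂))

      φb₂∼b : φ b₂ ∼[ W₁ ] b
      φb₂∼b = ∼-trans (∼-sym (φ-∼ (supp-mono V∖W₁⊆V b₂∈𝒱₁)))
                      (congruent (supp-≗ (λ u → xor-rearrange (x u) (b u) (keep W₂ a₁₂ u))
                                 (difference (keep-∼ (difference x∼b)))))

      orth : ∀ w → InSpan W₂ w → ℰ Γ₁ b₂ w ≡ false
      orth w w∈⟨W₂⟩ = begin
        ℰ Γ₁ b₂ w          ≡⟨ ℰ-Γ b₂ w ⟩
        ℰ G (φ b₂) (φ w)   ≡⟨ perp-respˡ G isGraph (φ-perp w) (proj₁ (φ-perp b₂)) (proj₁ b⊥W₁∪W₂) φb₂∼b ⟩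
        ℰ G b (φ w)        ≡⟨ perp-resp G b⊥W₁∪W₂ (∼-mono W₁⊆W₁∪W₂ (∼-sym (φ-∼ (supp-mono W₂⊆V w⊆W₂)))) ⟩
        ℰ G b w            ≡⟨ perp-orth G b⊥W₁∪W₂ (supp-mono W₂⊆W₁∪W₂ w⊆W₂) ⟩
        false              ∎
        where
        w⊆W₂ : Supp W₂ w
        w⊆W₂ = span⇒supp w∈⟨W₂⟩

  -- Γ_{W₁∪W₂}(G) = Γ_{W₂}(Γ₁): both have vertex set V ∖ (W₁ ∪ W₂), and for such u
  -- the representative u' in G and the lift φ(u'') of the representative u'' in Γ₁
  -- are ⟨W₁ ∪ W₂⟩^⊥-representatives of the same class, so ℰ agrees on them.
  reduction-∪ : (r₂ : Reducible Γ₁ W₂) (r₁₂ : Reducible G (W₁ ∪ W₂)) →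
    Γ G (W₁ ∪ W₂) r₁₂ ≅ Γ Γ₁ W₂ r₂
  reduction-∪ r₂ r₁₂ = same-vertices , same-adjacency
    where
    same-vertices : V ─ (W₁ ∪ W₂) ≡ V ─ W₁ ─ W₂
    same-vertices = sym (p─q─r≡p─q∪r V W₁ W₂)

    rep-G rep-Γ₁ : Fin n → Vect n
    rep-G  = perpPart G (W₁ ∪ W₂) r₁₂
    rep-Γ₁ = perpPart Γ₁ W₂ r₂

    same-class : ∀ {u} → u ∈ V ─ (W₁ ∪ W₂) → rep-G u ∼[ W₁ ∪ W₂ ] φ (rep-Γ₁ u)
    same-class {u} u∈V∖W₁₂ =
      ∼-trans (∼-sym (perpPart-∼ G r₁₂ (V∖W₁⊆V u∈V∖W₁)))
     (∼-trans (∼-mono W₂⊆W₁∪W₂ (perpPart-∼ Γ₁ r₂ u∈V∖W₁))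
              (∼-mono W₁⊆W₁∪W₂ (φ-∼ (supp-mono V∖W₁⊆V (proj₁ (perpPart-perp Γ₁ r₂ u))))))
      where
      u∈V∖W₁ : u ∈ V ─ W₁
      u∈V∖W₁ = proj₁ (x∈p─q⁻ (V ─ W₁) W₂ (subst (u ∈_) same-vertices u∈V∖W₁₂))

    same-adjacency : ∀ u v → u ∈ V ─ (W₁ ∪ W₂) → v ∈ V ─ (W₁ ∪ W₂) →
      ℰ G (rep-G u) (rep-G v) ≡ ℰ Γ₁ (rep-Γ₁ u) (rep-Γ₁ v)
    same-adjacency u v u∈ v∈ = begin
      ℰ G (rep-G u) (rep-G v)
        ≡⟨ ℰ-perp-invariant G isGraph (perpPart-perp G r₁₂ u) (φ-perp-∪ (perpPart-perp Γ₁ r₂ u))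
             (φ-perp-∪ (perpPart-perp Γ₁ r₂ v)) (same-class u∈) (same-class v∈) ⟩
      ℰ G (φ (rep-Γ₁ u)) (φ (rep-Γ₁ v))
        ≡⟨ ℰ-Γ (rep-Γ₁ u) (rep-Γ₁ v) ⟨
      ℰ Γ₁ (rep-Γ₁ u) (rep-Γ₁ v)
        ∎

mainTheorem1 : ∀ {n} (G : RawGraph n) → IsGraph G →
    (W₁ W₂ : Subset n) → W₁ ⊆ vertices G → W₂ ⊆ vertices G →
    (∀ v → v ∈ W₁ → v ∉ W₂) →
    (r₁ : Reducible G W₁) →
    (Reducible (Γ G W₁ r₁) W₂ ⇔ Reducible G (W₁ ∪ W₂)) ×
    ((r₂ : Reducible (Γ G W₁ r₁) W₂) → (r₁₂ : Reducible G (W₁ ∪ W₂)) →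
      Γ G (W₁ ∪ W₂) r₁₂ ≅ Γ (Γ G W₁ r₁) W₂ r₂)
mainTheorem1 G isGraph W₁ W₂ _ W₂⊆V disjoint r₁ =
  mk⇔ reducible-∪ reducible-Γ , reduction-∪
  where
  open TwoStepReduction G isGraph W₁ W₂ W₂⊆V disjoint r₁
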